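{- Let $P$ be a finite poset and $\sigma:P\to P$ an anti-automorphism. If $\sigma$ has two distinct fixed points, then $P$ is $1/2$-balanced.
   Context: An anti-automorphism of a poset $P$ is a bijection $\sigma:P\to P$ such that $x\le_P y$ if and only if $\sigma(y)\le_P\sigma(x)$. For distinct $x,y\in P$, $\mathbb{P}(x\prec y)$ is the proportion of linear extensions of $P$ (total orders of $P$ compatible with $\le_P$) in which $x$ comes before $y$. $P$ is $1/2$-balanced if there are distinct $x,y\in P$ with $\mathbb{P}(x\prec y)=1/2$. -}

module Defs where

open import Level using (0ℓ)
open import Data.Nat using (ℕ; _*_)
open import Data.Bool using (Bool; true; false; _∧_; if_then_else_)
open import Data.Fin using (Fin)
open import Data.Fin.Properties using (_≟_)
open import Data.List using (List; []; _∷_; map; concatMap; filter; length; allFin)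
open import Data.Bool.ListAction using (all)
open import Data.Product using (∃₂; _×_)
open import Relation.Nullary using (¬_; does)
open import Relation.Binary using (Rel; Decidable; IsPartialOrder)
open import Relation.Binary.PropositionalEquality using (_≡_)
open import Function.Bundles using (_⇔_)
open import Function.Definitions using (Bijective)

-- A finite poset, presented (up to isomorphism) on the carrier Fin n,
-- with a decidable order relation (automatic for finite posets classically;
-- needed to count linear extensions).
record FinPoset (n : ℕ) : Set₁ where
  field
    _≤_            : Rel (Fin n) 0ℓ
    isPartialOrder : IsPartialOrder _≡_ _≤_
    _≤?_           : Decidable _≤_

insertEverywhere : {A : Set} → A → List A → List (List A)
insertEverywhere x []       = (x ∷ []) ∷ []
insertEverywhere x (y ∷ ys) = (x ∷ y ∷ ys) ∷ map (y ∷_) (insertEverywhere x ys)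

permutations : {A : Set} → List A → List (List A)
permutations []       = [] ∷ []
permutations (x ∷ xs) = concatMap (insertEverywhere x) (permutations xs)

totalOrders : (n : ℕ) → List (List (Fin n))
totalOrders n = permutations (allFin n)

before : {n : ℕ} → Fin n → Fin n → List (Fin n) → Bool
before x y []       = false
before x y (z ∷ zs) =
  if does (z ≟ x) then elemB y zs
  else if does (z ≟ y) then false
  else before x y zs
  where
  elemB : {n : ℕ} → Fin n → List (Fin n) → Bool
  elemB a []       = false
  elemB a (b ∷ bs) = if does (a ≟ b) then true else elemB a bs

module _ {n : ℕ} (P : FinPoset n) where
  open FinPoset P

  isLinearExtension : List (Fin n) → Bool
  isLinearExtension l =
    all (λ x → all (λ y →
      if does (x ≟ y) then true
      else if does (x ≤? y) then before x y l
      else true) (allFin n)) (allFin n)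

  linearExtensions : List (List (Fin n))
  linearExtensions = filter (λ l → isLinearExtension l ≡? true) (totalOrders n)
    where
    open import Data.Bool.Properties using () renaming (_≟_ to _≡?_)

  #before : Fin n → Fin n → ℕ
  #before x y = length (filter (λ l → before x y l ≡? true) linearExtensions)
    where
    open import Data.Bool.Properties using () renaming (_≟_ to _≡?_)

  -- P(x ≺ y) = 1/2, i.e. 2 · #{L : x ≺_L y} = #{L}
  ProbHalf : Fin n → Fin n → Set
  ProbHalf x y = 2 * #before x y ≡ length linearExtensions

  HalfBalanced : Set
  HalfBalanced = ∃₂ λ x y → ¬ (x ≡ y) × ProbHalf x y

  IsAntiAutomorphism : (Fin n → Fin n) → Set
  IsAntiAutomorphism σ =
    Bijective _≡_ _≡_ σ × (∀ x y → (x ≤ y) ⇔ (σ y ≤ σ x))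

-- Let σ be an anti-automorphism of P.  Reversing the image of a linear extension L under σ,
-- i.e. reverse (map σ L), is again a linear extension, and this operation is injective.
-- If a and b are fixed by σ, it sends every extension with a before b to one with b before a,
-- so there are at most as many of the first kind as of the second, and by symmetry exactly as
-- many.  As every linear extension puts exactly one of a, b first, each kind is half of all.
module Submission where

open import Defs
open import Data.Nat using (ℕ; suc; _+_; _*_; _≤_; z≤n; s≤s)
open import Data.Nat.Properties using (+-suc; +-identityʳ; ≤-antisym)
open import Data.Bool using (Bool; true; false; not; if_then_else_)
open import Data.Bool.ListAction using (all)
open import Data.Bool.Properties using (T-≡) renaming (_≟_ to _≟ᵇ_)
open import Data.Fin using (Fin)
open import Data.Fin.Properties using (_≟_)
open import Data.List using (List; []; _∷_; _++_; [_]; map; concatMap; filter; length; reverse; allFin)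
open import Data.List.Properties
  using (map-++; reverse-++; unfold-reverse; ++-assoc; ∷-injective; length-map; map-injective; reverse-injective)
open import Data.List.Membership.Propositional using (_∈_; _∉_)
open import Data.List.Membership.Propositional.Properties
  using (∈-∃++; ∈-map⁺; ∈-map⁻; ∈-++⁺ˡ; ∈-++⁺ʳ; ∈-concat⁺′; ∈-concat⁻′; ∈-allFin; ∈-filter⁺; ∈-filter⁻)
open import Data.List.Membership.Propositional.Properties.WithK using (unique∧set⇒bag)
open import Data.List.Relation.Unary.Any using (here; there)
import Data.List.Relation.Unary.Any as Any
import Data.List.Relation.Unary.Any.Properties as Anyₚ
import Data.List.Relation.Unary.All as All
import Data.List.Relation.Unary.All.Properties as All
open import Data.List.Relation.Unary.AllPairs using ([]; _∷_)
open import Data.List.Relation.Unary.Unique.Propositional using (Unique)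
import Data.List.Relation.Unary.Unique.Propositional.Properties as Unique
open import Data.List.Relation.Binary.Disjoint.Propositional using (Disjoint)
open import Data.List.Relation.Binary.Subset.Propositional using (_⊆_)
open import Data.List.Relation.Binary.Permutation.Propositional using (_↭_; ↭⇒↭ₛ; prep; ↭-refl; ↭-sym; ↭-trans)
open import Data.List.Relation.Binary.Permutation.Propositional.Properties
  using (shift; drop-mid; ↭-empty-inv; ↭-length; ↭-reverse; ∈-resp-↭)
import Data.List.Relation.Binary.Permutation.Setoid.Properties as Permutationₛ
open import Data.List.Relation.Binary.BagAndSetEquality using (∼bag⇒↭)
open import Data.Product using (∃₂; _×_; _,_; proj₁; proj₂)
open import Data.Empty using (⊥-elim)
open import Function using (_∘′_; case_of_)
open import Function.Bundles using (_⇔_; mk⇔; Equivalence)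
open import Function.Definitions using (Injective; Surjective; Bijective)
open import Relation.Nullary using (¬_; yes; no; does)
open import Relation.Binary.PropositionalEquality
  using (_≡_; _≢_; refl; sym; trans; cong; cong₂; subst; subst₂; setoid; module ≡-Reasoning)

open Equivalence using (to; from)
open ≡-Reasoning

private
  variable
    A B : Set
    x y v : A
    xs ys zs l : List A

Unique-resp-↭ : xs ↭ ys → Unique xs → Unique ys
Unique-resp-↭ p = Permutationₛ.Unique-resp-↭ (setoid _) (↭⇒↭ₛ p)

∈-++-∷⁻ : ∀ l₁ l₂ → x ∈ l₁ ++ v ∷ l₂ → x ≢ v → x ∈ l₁ ++ l₂
∈-++-∷⁻ {v = v} l₁ l₂ x∈ x≢v with ∈-resp-↭ (shift v l₁ l₂) x∈
... | here x≡v = ⊥-elim (x≢v x≡v)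
... | there x∈′ = x∈′

length-mono-⊆ : Unique xs → xs ⊆ ys → length xs ≤ length ys
length-mono-⊆ {xs = []} _ _ = z≤n
length-mono-⊆ {xs = x ∷ xs} (x∉xs ∷ u) xs⊆ys with ∈-∃++ (xs⊆ys (here refl))
... | l₁ , l₂ , refl =
  subst (suc (length xs) ≤_) (sym (↭-length (shift x l₁ l₂)))
    (s≤s (length-mono-⊆ u λ z∈xs →
      ∈-++-∷⁻ l₁ l₂ (xs⊆ys (there z∈xs)) (λ { refl → All.lookup x∉xs z∈xs refl })))

length-filter-complement : (p q : A → Bool) (xs : List A) → (∀ {z} → z ∈ xs → q z ≡ not (p z)) →
  length (filter (λ z → p z ≟ᵇ true) xs) + length (filter (λ z → q z ≟ᵇ true) xs) ≡ length xs
length-filter-complement p q [] _ = refl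
length-filter-complement p q (z ∷ zs) q≡¬p rewrite q≡¬p (here refl) with p z
... | true  = cong suc (length-filter-complement p q zs (q≡¬p ∘′ there))
... | false = trans (+-suc _ _) (cong suc (length-filter-complement p q zs (q≡¬p ∘′ there)))

reverse-++-∷ : (l₁ : List A) (x : A) (l₂ : List A) → reverse (l₁ ++ x ∷ l₂) ≡ reverse l₂ ++ x ∷ reverse l₁
reverse-++-∷ l₁ x l₂ = begin
  reverse (l₁ ++ x ∷ l₂)              ≡⟨ reverse-++ l₁ (x ∷ l₂) ⟩
  reverse (x ∷ l₂) ++ reverse l₁      ≡⟨ cong (_++ reverse l₁) (unfold-reverse x l₂) ⟩
  (reverse l₂ ++ [ x ]) ++ reverse l₁ ≡⟨ ++-assoc (reverse l₂) [ x ] (reverse l₁) ⟩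
  reverse l₂ ++ x ∷ reverse l₁        ∎

Precedes : A → A → List A → Set
Precedes x y l = ∃₂ λ l₁ l₂ → l ≡ l₁ ++ x ∷ l₂ × y ∈ l₂

Precedes-map⁺ : (f : A → B) → Precedes x y l → Precedes (f x) (f y) (map f l)
Precedes-map⁺ {x = x} f (l₁ , l₂ , refl , y∈l₂) =
  map f l₁ , map f l₂ , map-++ f l₁ (x ∷ l₂) , ∈-map⁺ f y∈l₂

Precedes-reverse⁺ : Precedes x y l → Precedes y x (reverse l)
Precedes-reverse⁺ {x = x} {y = y} (l₁ , l₂ , refl , y∈l₂) with ∈-∃++ y∈l₂
... | m₁ , m₂ , refl =
  reverse m₂ , reverse m₁ ++ x ∷ reverse l₁ , reversed , ∈-++⁺ʳ (reverse m₁) (here refl)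
  where
  reversed : reverse (l₁ ++ x ∷ m₁ ++ y ∷ m₂) ≡ reverse m₂ ++ y ∷ reverse m₁ ++ x ∷ reverse l₁
  reversed = begin
    reverse (l₁ ++ x ∷ m₁ ++ y ∷ m₂)                 ≡⟨ reverse-++-∷ l₁ x (m₁ ++ y ∷ m₂) ⟩
    reverse (m₁ ++ y ∷ m₂) ++ x ∷ reverse l₁         ≡⟨ cong (_++ x ∷ reverse l₁) (reverse-++-∷ m₁ y m₂) ⟩
    (reverse m₂ ++ y ∷ reverse m₁) ++ x ∷ reverse l₁ ≡⟨ ++-assoc (reverse m₂) (y ∷ reverse m₁) (x ∷ reverse l₁) ⟩
    reverse m₂ ++ y ∷ reverse m₁ ++ x ∷ reverse l₁   ∎

∈-insertEverywhere⁻ : ∀ ys {w} → w ∈ insertEverywhere x ys →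
  ∃₂ λ l₁ l₂ → ys ≡ l₁ ++ l₂ × w ≡ l₁ ++ x ∷ l₂
∈-insertEverywhere⁻ [] (here refl) = [] , [] , refl , refl
∈-insertEverywhere⁻ (y ∷ ys) (here refl) = [] , y ∷ ys , refl , refl
∈-insertEverywhere⁻ (y ∷ ys) (there w∈) with ∈-map⁻ (y ∷_) w∈
... | w′ , w′∈ , refl with ∈-insertEverywhere⁻ ys w′∈
... | l₁ , l₂ , refl , refl = y ∷ l₁ , l₂ , refl , refl

∈-insertEverywhere⁺ : ∀ l₁ l₂ → l₁ ++ x ∷ l₂ ∈ insertEverywhere x (l₁ ++ l₂)
∈-insertEverywhere⁺ [] [] = here refl
∈-insertEverywhere⁺ [] (y ∷ l₂) = here refl
∈-insertEverywhere⁺ (y ∷ l₁) l₂ = there (∈-map⁺ (y ∷_) (∈-insertEverywhere⁺ l₁ l₂))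

∈-permutations⇔ : (xs : List A) {w : List A} → w ∈ permutations xs ⇔ (w ↭ xs)
∈-permutations⇔ xs = mk⇔ (sound xs) (complete xs)
  where
  sound : ∀ {w} xs → w ∈ permutations xs → w ↭ xs
  sound [] (here refl) = ↭-refl
  sound (x ∷ xs) w∈ with ∈-concat⁻′ (map (insertEverywhere x) (permutations xs)) w∈
  ... | _ , w∈ins , ins∈ with ∈-map⁻ (insertEverywhere x) ins∈
  ... | ys , ys∈ , refl with ∈-insertEverywhere⁻ ys w∈ins
  ... | l₁ , l₂ , refl , refl = ↭-trans (shift x l₁ l₂) (prep x (sound xs ys∈))

  complete : ∀ {w} xs → w ↭ xs → w ∈ permutations xs
  complete [] w↭[] with ↭-empty-inv w↭[]
  ... | refl = here refl
  complete (x ∷ xs) w↭ with ∈-∃++ (∈-resp-↭ (↭-sym w↭) (here refl))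
  ... | l₁ , l₂ , refl =
    ∈-concat⁺′ (∈-insertEverywhere⁺ l₁ l₂)
      (∈-map⁺ (insertEverywhere x) (complete xs (drop-mid l₁ [] w↭)))

concatMap-unique : (f : A → List B) → Unique xs →
  (∀ {y} → y ∈ xs → Unique (f y)) →
  (∀ {y z} → y ∈ xs → z ∈ xs → y ≢ z → Disjoint (f y) (f z)) →
  Unique (concatMap f xs)
concatMap-unique f [] _ _ = []
concatMap-unique {xs = x ∷ xs} f (x∉xs ∷ u) fUnique fDisjoint =
  Unique.++⁺ (fUnique (here refl))
    (concatMap-unique f u (fUnique ∘′ there) (λ y∈ z∈ → fDisjoint (there y∈) (there z∈)))
    headDisjoint
  where
  headDisjoint : Disjoint (f x) (concatMap f xs)
  headDisjoint (v∈fx , v∈rest) with ∈-concat⁻′ (map f xs) v∈rest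
  ... | _ , v∈fy , fy∈ with ∈-map⁻ f fy∈
  ... | y , y∈xs , refl = fDisjoint (here refl) (there y∈xs) (All.lookup x∉xs y∈xs) (v∈fx , v∈fy)

++-∷-cancel : ∀ l₁ l₂ k₁ k₂ → x ∉ l₁ → x ∉ k₁ → l₁ ++ x ∷ l₂ ≡ k₁ ++ x ∷ k₂ → l₁ ++ l₂ ≡ k₁ ++ k₂
++-∷-cancel [] l₂ [] k₂ _ _ eq = proj₂ (∷-injective eq)
++-∷-cancel [] l₂ (k ∷ k₁) k₂ _ x∉k eq = ⊥-elim (x∉k (here (proj₁ (∷-injective eq))))
++-∷-cancel (l ∷ l₁) l₂ [] k₂ x∉l _ eq = ⊥-elim (x∉l (here (sym (proj₁ (∷-injective eq)))))
++-∷-cancel (l ∷ l₁) l₂ (k ∷ k₁) k₂ x∉l x∉k eq =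
  cong₂ _∷_ (proj₁ (∷-injective eq))
    (++-∷-cancel l₁ l₂ k₁ k₂ (x∉l ∘′ there) (x∉k ∘′ there) (proj₂ (∷-injective eq)))

insertEverywhere-unique : x ∉ ys → Unique (insertEverywhere x ys)
insertEverywhere-unique {ys = []} _ = All.[] ∷ []
insertEverywhere-unique {x = x} {ys = y ∷ ys} x∉ =
  All.tabulate head≢ ∷ Unique.map⁺ (proj₂ ∘′ ∷-injective) (insertEverywhere-unique (x∉ ∘′ there))
  where
  head≢ : ∀ {w} → w ∈ map (y ∷_) (insertEverywhere x ys) → x ∷ y ∷ ys ≢ w
  head≢ w∈ eq with ∈-map⁻ (y ∷_) w∈
  ... | _ , _ , refl = x∉ (here (proj₁ (∷-injective eq)))

insertEverywhere-disjoint : x ∉ ys → x ∉ zs → ys ≢ zs →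
  Disjoint (insertEverywhere x ys) (insertEverywhere x zs)
insertEverywhere-disjoint {ys = ys} {zs = zs} x∉ys x∉zs ys≢zs (w∈ys , w∈zs)
  with ∈-insertEverywhere⁻ ys w∈ys | ∈-insertEverywhere⁻ zs w∈zs
... | l₁ , l₂ , refl , refl | k₁ , k₂ , refl , eq =
  ys≢zs (++-∷-cancel l₁ l₂ k₁ k₂ (x∉ys ∘′ ∈-++⁺ˡ) (x∉zs ∘′ ∈-++⁺ˡ) eq)

permutations-unique : Unique xs → Unique (permutations xs)
permutations-unique {xs = []} _ = All.[] ∷ []
permutations-unique {xs = x ∷ xs} (x∉xs ∷ u) =
  concatMap-unique (insertEverywhere x) (permutations-unique u)
    (insertEverywhere-unique ∘′ x∉)
    (λ ys∈ zs∈ → insertEverywhere-disjoint (x∉ ys∈) (x∉ zs∈))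
  where
  x∉ : ∀ {ys} → ys ∈ permutations xs → x ∉ ys
  x∉ ys∈ x∈ys = All.lookup x∉xs (∈-resp-↭ (to (∈-permutations⇔ xs) ys∈) x∈ys) refl

-- `before` tests membership with a `where`-bound function that cannot be named,
-- so it is only ever unfolded through the following equations.
module _ {n : ℕ} {x y : Fin n} where

  before-x∷[] : before x y (x ∷ []) ≡ false
  before-x∷[] with x ≟ x
  ... | yes _   = refl
  ... | no x≢x = ⊥-elim (x≢x refl)

  before-x∷z∷ : ∀ z zs → before x y (x ∷ z ∷ zs) ≡ (if does (y ≟ z) then true else before x y (x ∷ zs))
  before-x∷z∷ z zs with x ≟ x
  ... | yes _   = refl
  ... | no x≢x = ⊥-elim (x≢x refl)

  before-y∷ : ∀ zs → y ≢ x → before x y (y ∷ zs) ≡ false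
  before-y∷ zs y≢x with y ≟ x | y ≟ y
  ... | yes y≡x | _      = ⊥-elim (y≢x y≡x)
  ... | no _    | yes _  = refl
  ... | no _    | no y≢y = ⊥-elim (y≢y refl)

  before-z∷ : ∀ z zs → z ≢ x → z ≢ y → before x y (z ∷ zs) ≡ before x y zs
  before-z∷ z zs z≢x z≢y with z ≟ x | z ≟ y
  ... | yes z≡x | _       = ⊥-elim (z≢x z≡x)
  ... | no _    | yes z≡y = ⊥-elim (z≢y z≡y)
  ... | no _    | no _    = refl

  before-x∷⁺ : ∀ {zs} → y ∈ zs → before x y (x ∷ zs) ≡ true
  before-x∷⁺ {z ∷ zs} y∈ rewrite before-x∷z∷ z zs with y ≟ z | y∈
  ... | yes _   | _          = refl
  ... | no y≢z | here y≡z   = ⊥-elim (y≢z y≡z)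
  ... | no _   | there y∈zs = before-x∷⁺ y∈zs

  before-x∷⁻ : ∀ zs → before x y (x ∷ zs) ≡ true → y ∈ zs
  before-x∷⁻ [] b rewrite before-x∷[] with b
  ... | ()
  before-x∷⁻ (z ∷ zs) b rewrite before-x∷z∷ z zs with y ≟ z
  ... | yes y≡z = here y≡z
  ... | no _    = there (before-x∷⁻ zs b)

  before⇒Precedes : ∀ l → before x y l ≡ true → Precedes x y l
  -- A `with` here would abstract `z ≟ x` inside the type of b and block those equations.
  before⇒Precedes (z ∷ zs) b = case ((z ≟ x) , (z ≟ y)) of λ where
    (yes refl , _)       → [] , zs , refl , before-x∷⁻ zs b
    (no z≢x , yes refl) → case trans (sym b) (before-y∷ zs z≢x) of λ ()
    (no z≢x , no z≢y)   →
      let l₁ , l₂ , zs≡ , y∈l₂ = before⇒Precedes zs (trans (sym (before-z∷ z zs z≢x z≢y)) b)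
      in z ∷ l₁ , l₂ , cong (z ∷_) zs≡ , y∈l₂

  Precedes⇒before : ∀ {l} → Unique l → Precedes x y l → before x y l ≡ true
  Precedes⇒before _ ([] , l₂ , refl , y∈l₂) = before-x∷⁺ y∈l₂
  Precedes⇒before (z∉ ∷ u) (z ∷ l₁ , l₂ , refl , y∈l₂) =
    trans (before-z∷ z (l₁ ++ x ∷ l₂) (λ { refl → All.lookup z∉ (∈-++⁺ʳ l₁ (here refl)) refl })
                                        (λ { refl → All.lookup z∉ (∈-++⁺ʳ l₁ (there y∈l₂)) refl }))
           (Precedes⇒before u (l₁ , l₂ , refl , y∈l₂))

before-flip : ∀ {n} {x y : Fin n} l → x ∈ l → y ∈ l → x ≢ y → before y x l ≡ not (before x y l)
before-flip {x = x} {y} (z ∷ zs) x∈ y∈ x≢y = case ((z ≟ x) , (z ≟ y)) of λ where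
  (yes refl , _) →
    trans (before-y∷ zs x≢y) (cong not (sym (before-x∷⁺ {x = x} (Any.tail (x≢y ∘′ sym) y∈))))
  (no z≢x , yes refl) →
    trans (before-x∷⁺ {x = y} (Any.tail (z≢x ∘′ sym) x∈)) (cong not (sym (before-y∷ zs z≢x)))
  (no z≢x , no z≢y) →
    begin
      before y x (z ∷ zs)     ≡⟨ before-z∷ z zs z≢y z≢x ⟩
      before y x zs           ≡⟨ before-flip zs (Any.tail (z≢x ∘′ sym) x∈) (Any.tail (z≢y ∘′ sym) y∈) x≢y ⟩
      not (before x y zs)     ≡⟨ cong not (before-z∷ z zs z≢x z≢y) ⟨
      not (before x y (z ∷ zs)) ∎

module _ {n : ℕ} where

  ∈-totalOrders⇔ : {l : List (Fin n)} → l ∈ totalOrders n ⇔ (Unique l × (∀ i → i ∈ l))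
  ∈-totalOrders⇔ {l} = mk⇔
    (λ l∈ → let l↭ = to (∈-permutations⇔ (allFin n)) l∈ in
      Unique-resp-↭ (↭-sym l↭) (Unique.allFin⁺ n) , λ i → ∈-resp-↭ (↭-sym l↭) (∈-allFin i))
    (λ (u , complete) → from (∈-permutations⇔ (allFin n))
      (∼bag⇒↭ (unique∧set⇒bag u (Unique.allFin⁺ n) (mk⇔ (λ _ → ∈-allFin _) (λ _ → complete _)))))

  all-allFin⇔ : (p : Fin n → Bool) → all p (allFin n) ≡ true ⇔ (∀ i → p i ≡ true)
  all-allFin⇔ p = mk⇔
    (λ h i → to T-≡ (All.lookup (All.all⁺ p (allFin n) (from T-≡ h)) (∈-allFin i)))
    (λ h → to T-≡ (All.all⁻ p {allFin n} (All.tabulate λ {i} _ → from T-≡ (h i))))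

reverseMap : {A B : Set} → (A → B) → List A → List B
reverseMap f l = reverse (map f l)

module _ {A B : Set} {f : A → B} (f-injective : Injective _≡_ _≡_ f) where

  reverseMap-injective : Injective _≡_ _≡_ (reverseMap f)
  reverseMap-injective = map-injective f-injective ∘′ reverse-injective

  reverseMap-unique : {l : List A} → Unique l → Unique (reverseMap f l)
  reverseMap-unique {l} u = Unique-resp-↭ (↭-sym (↭-reverse (map f l))) (Unique.map⁺ f-injective u)

module _ {n : ℕ} {σ : Fin n → Fin n} where

  before-reverseMap : Injective _≡_ _≡_ σ → {x y : Fin n} {l : List (Fin n)} → Unique l →
    before x y l ≡ true → before (σ y) (σ x) (reverseMap σ l) ≡ true
  before-reverseMap σ-injective {l = l} u x≺y =
    Precedes⇒before (reverseMap-unique σ-injective u) (Precedes-reverse⁺ (Precedes-map⁺ σ (before⇒Precedes l x≺y)))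

  reverseMap-totalOrder : Bijective _≡_ _≡_ σ → {l : List (Fin n)} → l ∈ totalOrders n → reverseMap σ l ∈ totalOrders n
  reverseMap-totalOrder (σ-injective , σ-surjective) {l} l∈ =
    let u , complete = to ∈-totalOrders⇔ l∈ in
    from ∈-totalOrders⇔ (reverseMap-unique σ-injective u , λ i →
      let i′ , σi′≡i = σ-surjective i in
      Anyₚ.reverse⁺ (subst (_∈ map σ l) (σi′≡i refl) (∈-map⁺ σ (complete i′))))

module _ {n : ℕ} (P : FinPoset n) where
  open FinPoset P using (_≤?_) renaming (_≤_ to _⊑_)

  isLinearExtension-test⇔ : ∀ x y (b : Bool) →
    (if does (x ≟ y) then true else if does (x ≤? y) then b else true) ≡ true ⇔ (x ≢ y → x ⊑ y → b ≡ true)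
  isLinearExtension-test⇔ x y b with x ≟ y | x ≤? y
  ... | yes x≡y | _       = mk⇔ (λ _ x≢y → ⊥-elim (x≢y x≡y)) (λ _ → refl)
  ... | no x≢y  | yes x⊑y = mk⇔ (λ b≡true _ _ → b≡true) (λ h → h x≢y x⊑y)
  ... | no _    | no x⋢y  = mk⇔ (λ _ _ x⊑y → ⊥-elim (x⋢y x⊑y)) (λ _ → refl)

  isLinearExtension⇔ : (l : List (Fin n)) →
    isLinearExtension P l ≡ true ⇔ (∀ x y → x ≢ y → x ⊑ y → before x y l ≡ true)
  isLinearExtension⇔ l = mk⇔
    (λ h x y → to (isLinearExtension-test⇔ x y _) (to (all-allFin⇔ _) (to (all-allFin⇔ _) h x) y))
    (λ h → from (all-allFin⇔ _) λ x → from (all-allFin⇔ _) λ y → from (isLinearExtension-test⇔ x y _) (h x y))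

  ∈-linearExtensions⇔ : {l : List (Fin n)} →
    l ∈ linearExtensions P ⇔ (l ∈ totalOrders n × isLinearExtension P l ≡ true)
  ∈-linearExtensions⇔ = mk⇔
    (∈-filter⁻ (λ l → isLinearExtension P l ≟ᵇ true) {xs = totalOrders n})
    (λ (l∈ , l-ext) → ∈-filter⁺ (λ l → isLinearExtension P l ≟ᵇ true) l∈ l-ext)

  ∈-linearExtensions⇒totalOrder : {l : List (Fin n)} → l ∈ linearExtensions P → Unique l × (∀ i → i ∈ l)
  ∈-linearExtensions⇒totalOrder = to ∈-totalOrders⇔ ∘′ proj₁ ∘′ to ∈-linearExtensions⇔

  linearExtensions-unique : Unique (linearExtensions P)
  linearExtensions-unique =
    Unique.filter⁺ (λ l → isLinearExtension P l ≟ᵇ true) (permutations-unique (Unique.allFin⁺ n))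

  #before-+ : {x y : Fin n} → x ≢ y → #before P x y + #before P y x ≡ length (linearExtensions P)
  #before-+ {x} {y} x≢y = length-filter-complement (before x y) (before y x) (linearExtensions P) λ l∈ →
    let complete = proj₂ (∈-linearExtensions⇒totalOrder l∈) in
    before-flip _ (complete x) (complete y) x≢y

  module _ {σ : Fin n → Fin n} (anti : IsAntiAutomorphism P σ) where
    private
      σ-injective : Injective _≡_ _≡_ σ
      σ-injective = proj₁ (proj₁ anti)
      σ-surjective : Surjective _≡_ _≡_ σ
      σ-surjective = proj₂ (proj₁ anti)

    reverseMap-linearExtension : {l : List (Fin n)} → l ∈ linearExtensions P → reverseMap σ l ∈ linearExtensions P
    reverseMap-linearExtension {l} l∈ =
      from ∈-linearExtensions⇔ (reverseMap-totalOrder (proj₁ anti) l∈tot , from (isLinearExtension⇔ (reverseMap σ l)) ordered)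
      where
      l∈tot : l ∈ totalOrders n
      l∈tot = proj₁ (to ∈-linearExtensions⇔ l∈)
      l-ext : isLinearExtension P l ≡ true
      l-ext = proj₂ (to ∈-linearExtensions⇔ l∈)
      ordered : ∀ x y → x ≢ y → x ⊑ y → before x y (reverseMap σ l) ≡ true
      ordered x y x≢y x⊑y with σ-surjective x | σ-surjective y
      ... | x′ , σx′≡x | y′ , σy′≡y with σx′≡x refl | σy′≡y refl
      ... | refl | refl =
        before-reverseMap σ-injective (proj₁ (∈-linearExtensions⇒totalOrder l∈))
          (to (isLinearExtension⇔ l) l-ext y′ x′ (λ { refl → x≢y refl }) (from (proj₂ anti y′ x′) x⊑y))

    #before-≤ : {x y : Fin n} → σ x ≡ x → σ y ≡ y → #before P x y ≤ #before P y x
    #before-≤ {x} {y} σx≡x σy≡y =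
      subst (_≤ #before P y x) (length-map (reverseMap σ) x≺y-exts)
        (length-mono-⊆ (Unique.map⁺ (reverseMap-injective σ-injective)
                                    (Unique.filter⁺ (λ l → before x y l ≟ᵇ true) linearExtensions-unique))
                       image⊆)
      where
      x≺y-exts : List (List (Fin n))
      x≺y-exts = filter (λ l → before x y l ≟ᵇ true) (linearExtensions P)
      image⊆ : map (reverseMap σ) x≺y-exts ⊆ filter (λ l → before y x l ≟ᵇ true) (linearExtensions P)
      image⊆ l′∈ with ∈-map⁻ (reverseMap σ) l′∈
      ... | l , l∈ , refl with ∈-filter⁻ (λ l → before x y l ≟ᵇ true) {xs = linearExtensions P} l∈
      ... | l∈ext , x≺y =
        ∈-filter⁺ (λ l → before y x l ≟ᵇ true) (reverseMap-linearExtension l∈ext)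
          (subst₂ (λ u v → before u v (reverseMap σ l) ≡ true) σy≡y σx≡x
            (before-reverseMap σ-injective (proj₁ (∈-linearExtensions⇒totalOrder l∈ext)) x≺y))

proposition2p6 : (n : ℕ) (P : FinPoset n) (σ : Fin n → Fin n) →
    IsAntiAutomorphism P σ →
    (a b : Fin n) → ¬ (a ≡ b) → σ a ≡ a → σ b ≡ b →
    HalfBalanced P
proposition2p6 n P σ anti a b a≢b σa≡a σb≡b = a , b , a≢b , (begin
  2 * #before P a b                 ≡⟨ cong (#before P a b +_) (+-identityʳ _) ⟩
  #before P a b + #before P a b     ≡⟨ cong (#before P a b +_) #ab≡#ba ⟩
  #before P a b + #before P b a     ≡⟨ #before-+ P a≢b ⟩
  length (linearExtensions P)       ∎)
  where
  #ab≡#ba : #before P a b ≡ #before P b a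
  #ab≡#ba = ≤-antisym (#before-≤ P anti σa≡a σb≡b) (#before-≤ P anti σb≡b σa≡a)
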